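{- Let $E$ be a binary relation on $\mathbb{Q}^k$. If $E$ is smooth, has pseudo-algebraic length $1$, and is preserved by $mi$, then $E$ contains a min-clean tuple.
   Context: A binary relation on $\mathbb{Q}^k$ is a nonempty $E\subseteq\mathbb{Q}^k\times\mathbb{Q}^k$; smooth means its sets of first and second components coincide. For $a,b\in\mathbb{Q}^k$, $a\sim_k b$ iff $a_i\le a_j\Leftrightarrow b_i\le b_j$ for all $i,j$. $E$ has pseudo-algebraic length $1$ if the relation on $\sim_k$-classes containing $(A,B)$ iff some $(a,b)\in E$ has $a\in A,b\in B$ admits a closed walk of algebraic length $1$ (#forward minus #backward edges $=1$). For $a\in\mathbb{Q}^k$, $\min(a)$ is its least entry, $\mathrm{minx}(a)=\{i:a_i=\min(a)\}$. For $t=(t_1,t_2)$, $\min(t)$ is its least entry, $M(t)=\{i:\min(t_i)=\min(t)\}$, and $t$ is min-clean if $\mathrm{minx}(t_i)=\mathrm{minx}(t_j)$ for all $i,j\in M(t)$. Given strictly increasing $\alpha,\beta,\gamma:\mathbb{Q}\to\mathbb{Q}$ with $\alpha(x)<\beta(x)<\gamma(x)<\alpha(x+\epsilon)$ for all $x,\epsilon>0$, $mi(x,y)=\alpha(\min(x,y))$ if $x=y$, $\beta(\min(x,y))$ if $x<y$, $\gamma(\min(x,y))$ if $x>y$; "preserved by $mi$" means closed under componentwise application of $mi$ for every admissible choice of $\alpha,\beta,\gamma$. -}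

module Defs where

open import Data.Nat using (ℕ; zero; suc)
open import Data.Fin using (Fin; zero; suc)
open import Data.Rational using (ℚ; _≤_; _<_; _+_; _⊓_; 0ℚ)
open import Data.Product using (Σ; ∃; ∃-syntax; _×_; _,_)
open import Relation.Binary.PropositionalEquality using (_≡_)
open import Function using (_∘_)
open import Function.Bundles using (_⇔_)
open import Data.Rational.Properties using (<-cmp)
open import Relation.Binary.Definitions using (tri<; tri≈; tri>)

Qv : ℕ → Set
Qv k = Fin k → ℚ

BinRel : ℕ → Set₁
BinRel k = Qv k → Qv k → Set

Nonempty : ∀ {k} → BinRel k → Set
Nonempty {k} E = ∃[ a ] ∃[ b ] E a b

Smooth : ∀ {k} → BinRel k → Set
Smooth {k} E = (a : Qv k) → (∃[ b ] E a b) ⇔ (∃[ b ] E b a)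

_∼_ : ∀ {k} → Qv k → Qv k → Set
_∼_ {k} a b = (i j : Fin k) → (a i ≤ a j → b i ≤ b j) × (b i ≤ b j → a i ≤ a j)

-- edge of the induced relation on ∼-classes, classes given by representatives
ClassEdge : ∀ {k} → BinRel k → Qv k → Qv k → Set
ClassEdge {k} E x y = ∃[ a ] ∃[ b ] (E a b × (a ∼ x) × (b ∼ y))

-- Walk E x y f b : walk in the class relation from the class of x to the
-- class of y, using f forward edges and b backward edges.
data Walk {k : ℕ} (E : BinRel k) : Qv k → Qv k → ℕ → ℕ → Set where
  nil : ∀ {x} → Walk E x x 0 0
  fwd : ∀ {x y z f b} → ClassEdge E x y → Walk E y z f b → Walk E x z (suc f) b
  bwd : ∀ {x y z f b} → ClassEdge E y x → Walk E y z f b → Walk E x z f (suc b)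

PseudoAlgLength1 : ∀ {k} → BinRel k → Set
PseudoAlgLength1 {k} E = ∃[ x ] ∃[ y ] ∃[ f ] ∃[ b ] (Walk E x y f b × (y ∼ x) × (f ≡ suc b))

minQ : ∀ {n} → Qv (suc n) → ℚ
minQ {zero} a = a zero
minQ {suc n} a = a zero ⊓ minQ (a ∘ suc)

InMinx : ∀ {n} → Qv (suc n) → Fin (suc n) → Set
InMinx a i = a i ≡ minQ a

tup : ∀ {n} → Qv (suc n) → Qv (suc n) → Fin 2 → Qv (suc n)
tup a b zero = a
tup a b (suc _) = b

minT : ∀ {n} → (Fin 2 → Qv (suc n)) → ℚ
minT t = minQ (t zero) ⊓ minQ (t (suc zero))

InM : ∀ {n} → (Fin 2 → Qv (suc n)) → Fin 2 → Set
InM t i = minQ (t i) ≡ minT t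

MinClean : ∀ {n} → (Fin 2 → Qv (suc n)) → Set
MinClean {n} t = (i j : Fin 2) → InM t i → InM t j →
  (l : Fin (suc n)) → InMinx (t i) l ⇔ InMinx (t j) l

StrictlyIncreasing : (ℚ → ℚ) → Set
StrictlyIncreasing f = ∀ x y → x < y → f x < f y

Admissible : (ℚ → ℚ) → (ℚ → ℚ) → (ℚ → ℚ) → Set
Admissible α β γ =
  StrictlyIncreasing α × StrictlyIncreasing β × StrictlyIncreasing γ ×
  (∀ x ε → 0ℚ < ε → (α x < β x) × (β x < γ x) × (γ x < α (x + ε)))

mi : (ℚ → ℚ) → (ℚ → ℚ) → (ℚ → ℚ) → ℚ → ℚ → ℚ
mi α β γ x y with <-cmp x y
... | tri< _ _ _ = β (x ⊓ y)
... | tri≈ _ _ _ = α (x ⊓ y)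
... | tri> _ _ _ = γ (x ⊓ y)

miV : ∀ {k} → (ℚ → ℚ) → (ℚ → ℚ) → (ℚ → ℚ) → Qv k → Qv k → Qv k
miV α β γ a a' i = mi α β γ (a i) (a' i)

PreservedByMi : ∀ {k} → BinRel k → Set
PreservedByMi {k} E = (α β γ : ℚ → ℚ) → Admissible α β γ →
  (a b a' b' : Qv k) → E a b → E a' b' → E (miV α β γ a a') (miV α β γ b b')

-- Combining two edges of E coordinatewise with mi intersects the sets of
-- minimal coordinates of their sources, and of their targets, as long as
-- all four endpoints have the same minimum (which applying a shifted mi to
-- an edge and itself arranges).  If exactly one intersection is empty, the
-- combined edge has endpoints with different minima and is min-clean.
--
-- Smoothness gives a bi-infinite path c in E through the class of the
-- base point x of the closed walk.  Combining an edge of the walk with the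
-- edges leaving a window c h, …, c (h + m) moves the window by one step, so
-- going around the walk shows by induction on m that x, c 0, …, c m always
-- share a minimal coordinate.  By pigeonhole two of c 0, …, c (2 ^ k), say
-- c s and c (s + d + 1), have the same minimal coordinates; combining the
-- edges from c s to c (s + d + 1) then gives a min-clean edge.
--
-- An admissible triple, needed to use the hypothesis at all, is read off
-- from the Stern–Brocot tree written in base 4.

module Submission where

open import Defs
open import Level using (0ℓ)
open import Data.Nat using (ℕ; zero; suc; _+_; _*_; _∸_; _^_; z≤n; s≤s)
import Data.Nat as ℕ
import Data.Nat.Properties as ℕₚ
open import Data.Integer using (ℤ; +_; -[1+_]; 0ℤ; 1ℤ)
import Data.Integer as ℤ
import Data.Integer.Properties as ℤₚ
import Data.Integer.Solver as ℤ-Solver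
open import Data.Rational using (ℚ; _≤_; _<_; _⊓_; 0ℚ; 1ℚ)
import Data.Rational as ℚ
import Data.Rational.Properties as ℚₚ
import Data.Rational.Solver as ℚ-Solver
open import Data.Fin using (Fin; zero; suc; toℕ; funToFin; finToFun)
open import Data.Fin.Properties using (any?; pigeonhole; finToFun-funToFin; toℕ≤pred[n])
import Data.Product as Product
open import Data.Product using (Σ; Σ-syntax; ∃-syntax; _×_; _,_; proj₁; proj₂; curry)
open import Data.Sum using (_⊎_; inj₁; inj₂; [_,_]′; map₂)
open import Data.Empty using (⊥-elim)
open import Function using (_∘_; id)
open import Function.Bundles using (_⇔_; mk⇔; Equivalence)
open import Relation.Binary.PropositionalEquality
open import Relation.Binary.Definitions using (tri<; tri≈; tri>)
open import Relation.Nullary using (¬_; Dec; yes; no)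
open import Relation.Nullary.Decidable using (from-yes)
open import Relation.Unary using (Pred; Decidable; Satisfiable; Empty; _∩_; _⊆_; _≐_)
open import Relation.Unary.Properties using (≐-refl; ≐-sym; ≐-trans; _∩?_)

-- An admissible triple from the Stern–Brocot tree

record Cell : Set where
  constructor cell
  field lo mid₁ mid₂ hi : ℚ
open Cell

record Ordered (C : Cell) : Set where
  field
    0≤lo      : 0ℚ ≤ lo C
    lo<mid₁   : lo C < mid₁ C
    mid₁<mid₂ : mid₁ C < mid₂ C
    mid₂<hi   : mid₂ C < hi C
    hi≤1      : hi C ≤ 1ℚ
open Ordered

mapCell : (ℚ → ℚ) → Cell → Cell
mapCell f (cell a b c d) = cell (f a) (f b) (f c) (f d)

¼ : ℚ
¼ = + 1 ℚ./ 4

instance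
  ¼-positive : ℚ.Positive ¼
  ¼-positive = _

prependDigit : ℚ → ℚ → ℚ
prependDigit c t = (c ℚ.+ t) ℚ.* ¼

3ℚ : ℚ
3ℚ = + 3 ℚ./ 1

root : Cell
root = cell (+ 1 ℚ./ 2) (+ 9 ℚ./ 16) (+ 5 ℚ./ 8) (+ 3 ℚ./ 4)

-- The Stern–Brocot descent to p/q, read as base-4 digits: a left turn is
-- the digit 1, a right turn the digit 3, and the node itself occupies
-- [0.2, 0.3]₄.  Fuel n ≥ p + q suffices for p, q > 0.
sternBrocot : ℕ → ℕ → ℕ → Cell
sternBrocot zero    p q = root
sternBrocot (suc n) p q with ℕₚ.<-cmp p q
... | tri< _ _ _ = mapCell (prependDigit 1ℚ) (sternBrocot n p (q ∸ p))
... | tri≈ _ _ _ = root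
... | tri> _ _ _ = mapCell (prependDigit 3ℚ) (sternBrocot n (p ∸ q) q)

prependDigit-mono-< : ∀ c {x y} → x < y → prependDigit c x < prependDigit c y
prependDigit-mono-< c x<y = ℚₚ.*-monoˡ-<-pos ¼ (ℚₚ.+-monoʳ-< c x<y)

prependDigit-mono-≤ : ∀ c {x y} → x ≤ y → prependDigit c x ≤ prependDigit c y
prependDigit-mono-≤ c x≤y = ℚₚ.*-monoʳ-≤-nonNeg ¼ (ℚₚ.+-monoʳ-≤ c x≤y)

prependDigit-ordered : ∀ c → 0ℚ ≤ prependDigit c 0ℚ → prependDigit c 1ℚ ≤ 1ℚ →
                       ∀ C → Ordered C → Ordered (mapCell (prependDigit c) C)
prependDigit-ordered c f0 f1 C o = record
  { 0≤lo      = ℚₚ.≤-trans f0 (prependDigit-mono-≤ c (0≤lo o))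
  ; lo<mid₁   = prependDigit-mono-< c (lo<mid₁ o)
  ; mid₁<mid₂ = prependDigit-mono-< c (mid₁<mid₂ o)
  ; mid₂<hi   = prependDigit-mono-< c (mid₂<hi o)
  ; hi≤1      = ℚₚ.≤-trans (prependDigit-mono-≤ c (hi≤1 o)) f1
  }

root-ordered : Ordered root
root-ordered = record
  { 0≤lo      = from-yes (0ℚ ℚ.≤? lo root)
  ; lo<mid₁   = from-yes (lo root ℚ.<? mid₁ root)
  ; mid₁<mid₂ = from-yes (mid₁ root ℚ.<? mid₂ root)
  ; mid₂<hi   = from-yes (mid₂ root ℚ.<? hi root)
  ; hi≤1      = from-yes (hi root ℚ.≤? 1ℚ)
  }

sternBrocot-ordered : ∀ n p q → Ordered (sternBrocot n p q)
sternBrocot-ordered zero    p q = root-ordered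
sternBrocot-ordered (suc n) p q with ℕₚ.<-cmp p q
... | tri< _ _ _ = prependDigit-ordered 1ℚ (from-yes (0ℚ ℚ.≤? prependDigit 1ℚ 0ℚ))
                     (from-yes (prependDigit 1ℚ 1ℚ ℚ.≤? 1ℚ)) _ (sternBrocot-ordered n p (q ∸ p))
... | tri≈ _ _ _ = root-ordered
... | tri> _ _ _ = prependDigit-ordered 3ℚ (from-yes (0ℚ ℚ.≤? prependDigit 3ℚ 0ℚ))
                     (from-yes (prependDigit 3ℚ 1ℚ ℚ.≤? 1ℚ)) _ (sternBrocot-ordered n (p ∸ q) q)

private
  fuel-left : ∀ {n p q} → 0 ℕ.< p → p ℕ.< q → p + q ℕ.≤ suc n → p + (q ∸ p) ℕ.≤ n
  fuel-left {n} {p} {q} 0<p p<q le rewrite ℕₚ.m+[n∸m]≡n (ℕₚ.<⇒≤ p<q) =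
    ℕₚ.≤-pred (ℕₚ.<-≤-trans (ℕₚ.m<n+m q 0<p) le)

  fuel-right : ∀ {n p q} → 0 ℕ.< q → q ℕ.< p → p + q ℕ.≤ suc n → (p ∸ q) + q ℕ.≤ n
  fuel-right {n} {p} {q} 0<q q<p le rewrite ℕₚ.m∸n+n≡m (ℕₚ.<⇒≤ q<p) =
    ℕₚ.≤-pred (ℕₚ.<-≤-trans (ℕₚ.m<m+n p 0<q) le)

  cross-left : ∀ {p q r s} → r ℕ.< s → p * s ℕ.< r * q → p * (s ∸ r) ℕ.< r * (q ∸ p)
  cross-left {p} {q} {r} {s} r<s ps<rq
    rewrite ℕₚ.*-distribˡ-∸ p s r | ℕₚ.*-distribˡ-∸ r q p | ℕₚ.*-comm r p
    = ℕₚ.∸-monoˡ-< ps<rq (ℕₚ.*-monoʳ-≤ p (ℕₚ.<⇒≤ r<s))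

  cross-right : ∀ {p q r s} → q ℕ.< p → p * s ℕ.< r * q → (p ∸ q) * s ℕ.< (r ∸ s) * q
  cross-right {p} {q} {r} {s} q<p ps<rq
    rewrite ℕₚ.*-distribʳ-∸ s p q | ℕₚ.*-distribʳ-∸ q r s | ℕₚ.*-comm s q
    = ℕₚ.∸-monoˡ-< ps<rq (ℕₚ.*-monoˡ-≤ s (ℕₚ.<⇒≤ q<p))

  left-below-root : prependDigit 1ℚ 1ℚ ≤ lo root
  left-below-root = from-yes (prependDigit 1ℚ 1ℚ ℚ.≤? lo root)

  root-below-right : hi root ≤ prependDigit 3ℚ 0ℚ
  root-below-right = from-yes (hi root ℚ.≤? prependDigit 3ℚ 0ℚ)

  left-below-right : prependDigit 1ℚ 1ℚ ≤ prependDigit 3ℚ 0ℚ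
  left-below-right = from-yes (prependDigit 1ℚ 1ℚ ℚ.≤? prependDigit 3ℚ 0ℚ)

  hi-left : ∀ n p q → hi (mapCell (prependDigit 1ℚ) (sternBrocot n p q)) ≤ prependDigit 1ℚ 1ℚ
  hi-left n p q = prependDigit-mono-≤ 1ℚ (hi≤1 (sternBrocot-ordered n p q))

  lo-right : ∀ n p q → prependDigit 3ℚ 0ℚ ≤ lo (mapCell (prependDigit 3ℚ) (sternBrocot n p q))
  lo-right n p q = prependDigit-mono-≤ 3ℚ (0≤lo (sternBrocot-ordered n p q))

-- Every cell lies in [1/4, 1/2], [1/2, 3/4] or [3/4, 1] according to
-- the first turn; equal first turns are handled by induction.
sternBrocot-separated : ∀ n m p q r s → 0 ℕ.< p → 0 ℕ.< q → 0 ℕ.< r → 0 ℕ.< s →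
  p + q ℕ.≤ n → r + s ℕ.≤ m → p * s ℕ.< r * q →
  hi (sternBrocot n p q) ≤ lo (sternBrocot m r s)
sternBrocot-separated zero    m       (suc p) q r       s _ _ _ _ () _ _
sternBrocot-separated (suc n) zero    p       q (suc r) s _ _ _ _ _ () _
sternBrocot-separated (suc n) (suc m) p q r s 0<p 0<q 0<r 0<s pq≤ rs≤ ps<rq
  with ℕₚ.<-cmp p q | ℕₚ.<-cmp r s
... | tri< p<q _ _ | tri< r<s _ _ = prependDigit-mono-≤ 1ℚ
  (sternBrocot-separated n m p (q ∸ p) r (s ∸ r) 0<p (ℕₚ.m<n⇒0<n∸m p<q) 0<r (ℕₚ.m<n⇒0<n∸m r<s)
     (fuel-left 0<p p<q pq≤) (fuel-left 0<r r<s rs≤) (cross-left {p} {q} r<s ps<rq))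
... | tri< _ _ _ | tri≈ _ _ _ = ℚₚ.≤-trans (hi-left n p (q ∸ p)) left-below-root
... | tri< _ _ _ | tri> _ _ _ =
  ℚₚ.≤-trans (hi-left n p (q ∸ p)) (ℚₚ.≤-trans left-below-right (lo-right m (r ∸ s) s))
... | tri≈ _ refl _ | tri< r<s _ _ =
  ⊥-elim (ℕₚ.<-asym r<s (ℕₚ.*-cancelˡ-< p _ _ (subst (p * s ℕ.<_) (ℕₚ.*-comm r p) ps<rq)))
... | tri≈ _ refl _ | tri≈ _ refl _ = ⊥-elim (ℕₚ.<-irrefl (ℕₚ.*-comm p r) ps<rq)
... | tri≈ _ refl _ | tri> _ _ _ = ℚₚ.≤-trans root-below-right (lo-right m (r ∸ s) s)
... | tri> _ _ q<p | tri< r<s _ _ =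
  ⊥-elim (ℕₚ.<-asym ps<rq (subst (ℕ._< p * s) (ℕₚ.*-comm q r) (ℕₚ.*-mono-< q<p r<s)))
... | tri> _ _ q<p | tri≈ _ refl _ =
  ⊥-elim (ℕₚ.<-asym q<p (ℕₚ.*-cancelʳ-< r _ _ (subst (p * r ℕ.<_) (ℕₚ.*-comm r q) ps<rq)))
... | tri> _ _ q<p | tri> _ _ s<r = prependDigit-mono-≤ 3ℚ
  (sternBrocot-separated n m (p ∸ q) q (r ∸ s) s (ℕₚ.m<n⇒0<n∸m q<p) 0<q (ℕₚ.m<n⇒0<n∸m s<r) 0<s
     (fuel-right 0<q q<p pq≤) (fuel-right 0<s s<r rs≤) (cross-right {p} {q} {r} q<p ps<rq))

-- x ↦ x + 1 on [0, ∞) and x ↦ 1 / (1 - x) on (-∞, 0), as numerator and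
-- denominator; arguments are the numerator and denominator - 1 of x.
fraction : ℤ → ℕ → ℕ × ℕ
fraction (+ n)    d = n + suc d , suc d
fraction -[1+ n ] d = suc d , suc d + suc n

positivePair : ℚ → ℕ × ℕ
positivePair x = fraction (ℚ.numerator x) (ℚ.denominator-1 x)

positivePair-positive : ∀ x → 0 ℕ.< proj₁ (positivePair x) × 0 ℕ.< proj₂ (positivePair x)
positivePair-positive x with ℚ.numerator x
... | + n      = ℕₚ.<-≤-trans (s≤s z≤n) (ℕₚ.m≤n+m _ n) , s≤s z≤n
... | -[1+ n ] = s≤s z≤n , s≤s z≤n

fraction-mono : ∀ z z' d d′ → z ℤ.* + suc d′ ℤ.< z' ℤ.* + suc d →
  proj₁ (fraction z d) * proj₂ (fraction z' d′) ℕ.< proj₁ (fraction z' d′) * proj₂ (fraction z d)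
fraction-mono (+ n) (+ n′) d d′ lt = begin-strict
  (n + D) * E      ≡⟨ ℕₚ.*-distribʳ-+ E n D ⟩
  n * E + D * E    <⟨ ℕₚ.+-mono-<-≤ nE<n′D (ℕₚ.≤-reflexive (ℕₚ.*-comm D E)) ⟩
  n′ * D + E * D   ≡⟨ ℕₚ.*-distribʳ-+ D n′ E ⟨
  (n′ + E) * D     ∎
  where
  open ℕₚ.≤-Reasoning
  D = suc d
  E = suc d′
  nE<n′D : n * E ℕ.< n′ * D
  nE<n′D = ℤₚ.drop‿+<+ (subst₂ ℤ._<_ (sym (ℤₚ.pos-* n E)) (sym (ℤₚ.pos-* n′ D)) lt)
fraction-mono (+ n) -[1+ n′ ] d d′ lt = ⊥-elim (ℤₚ.+◃≮-◃ {n * suc d′} {suc n′ * suc d} lt)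
fraction-mono -[1+ n ] (+ n′) d d′ _ = begin-strict
  D * E              ≡⟨ ℕₚ.*-comm D E ⟩
  E * D              <⟨ ℕₚ.*-monoʳ-< E (ℕₚ.m<m+n D (s≤s z≤n)) ⟩
  E * (D + N)        ≤⟨ ℕₚ.*-monoˡ-≤ (D + N) (ℕₚ.m≤n+m E n′) ⟩
  (n′ + E) * (D + N) ∎
  where
  open ℕₚ.≤-Reasoning
  D = suc d
  E = suc d′
  N = suc n
fraction-mono -[1+ n ] -[1+ n′ ] d d′ lt = begin-strict
  D * (E + M)      ≡⟨ ℕₚ.*-distribˡ-+ D E M ⟩
  D * E + D * M    ≡⟨ cong (λ t → D * E + t) (ℕₚ.*-comm D M) ⟩
  D * E + M * D    <⟨ ℕₚ.+-monoʳ-< (D * E) (s≤s (ℤₚ.drop‿-<- lt)) ⟩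
  D * E + N * E    ≡⟨ cong₂ _+_ (ℕₚ.*-comm D E) (ℕₚ.*-comm N E) ⟩
  E * D + E * N    ≡⟨ ℕₚ.*-distribˡ-+ E D N ⟨
  E * (D + N)      ∎
  where
  open ℕₚ.≤-Reasoning
  D = suc d
  E = suc d′
  N = suc n
  M = suc n′

positivePair-mono : ∀ {x y} → x < y →
  proj₁ (positivePair x) * proj₂ (positivePair y) ℕ.< proj₁ (positivePair y) * proj₂ (positivePair x)
positivePair-mono {x} {y} (ℚ.*<* lt) =
  fraction-mono (ℚ.numerator x) (ℚ.numerator y) (ℚ.denominator-1 x) (ℚ.denominator-1 y) lt

cellOfPair : ℕ × ℕ → Cell
cellOfPair (p , q) = sternBrocot (p + q) p q

cellOfPair-ordered : ∀ pq → Ordered (cellOfPair pq)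
cellOfPair-ordered (p , q) = sternBrocot-ordered (p + q) p q

cellOf : ℚ → Cell
cellOf = cellOfPair ∘ positivePair

cellOf-separated : ∀ {x y} → x < y → hi (cellOf x) ≤ lo (cellOf y)
cellOf-separated {x} {y} x<y =
  sternBrocot-separated _ _ _ _ _ _ (proj₁ (positivePair-positive x)) (proj₂ (positivePair-positive x))
    (proj₁ (positivePair-positive y)) (proj₂ (positivePair-positive y))
    ℕₚ.≤-refl ℕₚ.≤-refl (positivePair-mono x<y)

x<x+ε : ∀ x {ε} → 0ℚ < ε → x < x ℚ.+ ε
x<x+ε x 0<ε = subst (_< x ℚ.+ _) (ℚₚ.+-identityʳ x) (ℚₚ.+-monoʳ-< x 0<ε)

sternBrocot-admissible : Admissible (lo ∘ cellOf) (mid₁ ∘ cellOf) (mid₂ ∘ cellOf)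
sternBrocot-admissible =
  (λ x y x<y → ℚₚ.<-≤-trans (lo<hi x) (cellOf-separated x<y)) ,
  (λ x y x<y → ℚₚ.<-trans (ℚₚ.<-≤-trans (mid₁<hi x) (cellOf-separated x<y)) (lo<mid₁ (ordered y))) ,
  (λ x y x<y → ℚₚ.<-trans (ℚₚ.<-≤-trans (mid₂<hi (ordered x)) (cellOf-separated x<y)) (lo<mid₂ y)) ,
  λ x ε 0<ε → lo<mid₁ (ordered x) , mid₁<mid₂ (ordered x) ,
              ℚₚ.<-≤-trans (mid₂<hi (ordered x)) (cellOf-separated (x<x+ε x 0<ε))
  where
  ordered = cellOfPair-ordered ∘ positivePair
  mid₁<hi : ∀ x → mid₁ (cellOf x) < hi (cellOf x)
  mid₁<hi x = ℚₚ.<-trans (mid₁<mid₂ (ordered x)) (mid₂<hi (ordered x))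
  lo<hi : ∀ x → lo (cellOf x) < hi (cellOf x)
  lo<hi x = ℚₚ.<-trans (lo<mid₁ (ordered x)) (mid₁<hi x)
  lo<mid₂ : ∀ x → lo (cellOf x) < mid₂ (cellOf x)
  lo<mid₂ x = ℚₚ.<-trans (lo<mid₁ (ordered x)) (mid₁<mid₂ (ordered x))

minQ-≤ : ∀ {n} (u : Qv (suc n)) j → minQ u ≤ u j
minQ-≤ {zero}  u zero    = ℚₚ.≤-refl
minQ-≤ {suc n} u zero    = ℚₚ.p⊓q≤p (u zero) (minQ (u ∘ suc))
minQ-≤ {suc n} u (suc j) = ℚₚ.≤-trans (ℚₚ.p⊓q≤q (u zero) (minQ (u ∘ suc))) (minQ-≤ (u ∘ suc) j)

minQ-attained : ∀ {n} (u : Qv (suc n)) → Satisfiable (InMinx u)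
minQ-attained {zero}  u = zero , refl
minQ-attained {suc n} u with ℚₚ.⊓-sel (u zero) (minQ (u ∘ suc))
... | inj₁ min≡u₀ = zero , sym min≡u₀
... | inj₂ min≡min′ with j , u′j≡min′ ← minQ-attained (u ∘ suc) =
  suc j , trans u′j≡min′ (sym min≡min′)

minQ-cong : ∀ {n} {u v : Qv (suc n)} → (∀ j → u j ≡ v j) → minQ u ≡ minQ v
minQ-cong {zero}  u≗v = u≗v zero
minQ-cong {suc n} u≗v = cong₂ _⊓_ (u≗v zero) (minQ-cong (u≗v ∘ suc))

module _ {n : ℕ} where

  attained-bound⇒minQ≡ : ∀ {u : Qv (suc n)} {m l} → (∀ j → m ≤ u j) → u l ≡ m → minQ u ≡ m
  attained-bound⇒minQ≡ {u} {m} {l} m≤u ul≡m with i , ui≡min ← minQ-attained u =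
    ℚₚ.≤-antisym (subst (minQ u ≤_) ul≡m (minQ-≤ u l)) (subst (m ≤_) ui≡min (m≤u i))

  minQ≡⇒≤ : ∀ {u : Qv (suc n)} {m} → minQ u ≡ m → ∀ j → m ≤ u j
  minQ≡⇒≤ {u} refl = minQ-≤ u

  minQ≡⇒InMinx≐ : ∀ {u : Qv (suc n)} {m} → minQ u ≡ m → InMinx u ≐ (λ j → u j ≡ m)
  minQ≡⇒InMinx≐ min≡m = (λ e → trans e min≡m) , (λ e → trans e (sym min≡m))

  InMinx-cong : ∀ {u v : Qv (suc n)} → (∀ j → u j ≡ v j) → InMinx u ≐ InMinx v
  InMinx-cong {u} {v} u≗v =
    (λ {j} e → trans (sym (u≗v j)) (trans e (minQ-cong u≗v))) ,
    (λ {j} e → trans (u≗v j) (trans e (sym (minQ-cong u≗v))))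

  InMinx? : (u : Qv (suc n)) → Decidable (InMinx u)
  InMinx? u j = u j ℚ.≟ minQ u

  ∼⇒InMinx⊆ : ∀ {u v : Qv (suc n)} → u ∼ v → InMinx u ⊆ InMinx v
  ∼⇒InMinx⊆ {u} {v} u∼v {l} ul≡min =
    sym (attained-bound⇒minQ≡ (λ j → proj₁ (u∼v l j) (subst (_≤ u j) (sym ul≡min) (minQ-≤ u j))) refl)

  ∼⇒InMinx≐ : ∀ {u v : Qv (suc n)} → u ∼ v → InMinx u ≐ InMinx v
  ∼⇒InMinx≐ u∼v = ∼⇒InMinx⊆ u∼v , ∼⇒InMinx⊆ (λ i j → proj₂ (u∼v i j) , proj₁ (u∼v i j))

private
  indicator : ∀ {A : Set} → Dec A → Fin 2
  indicator (yes _) = suc zero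
  indicator (no _)  = zero

  indicator-≡⇒ : ∀ {A B : Set} (a? : Dec A) (b? : Dec B) → indicator a? ≡ indicator b? → A → B
  indicator-≡⇒ _       (yes b) _  _ = b
  indicator-≡⇒ (yes _) (no _)  () _
  indicator-≡⇒ (no ¬a) (no _)  _  a = ⊥-elim (¬a a)

  minxPattern : ∀ {n} → Qv (suc n) → Fin (suc n) → Fin 2
  minxPattern u l = indicator (InMinx? u l)

minxCode : ∀ {n} → Qv (suc n) → Fin (2 ^ suc n)
minxCode = funToFin ∘ minxPattern

minxCode-injective : ∀ {n} {u v : Qv (suc n)} → minxCode u ≡ minxCode v → InMinx u ≐ InMinx v
minxCode-injective {u = u} {v} code≡ =
  (λ {l} → indicator-≡⇒ (InMinx? u l) (InMinx? v l) (same l)) ,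
  (λ {l} → indicator-≡⇒ (InMinx? v l) (InMinx? u l) (sym (same l)))
  where
  same : ∀ l → indicator (InMinx? u l) ≡ indicator (InMinx? v l)
  same l = trans (sym (finToFun-funToFin (minxPattern u) l))
                 (trans (cong (λ k → finToFun k l) code≡) (finToFun-funToFin (minxPattern v) l))

minx-repeats : ∀ {n} (u : ℕ → Qv (suc n)) →
  ∃[ i ] ∃[ d ] (i + d ℕ.< 2 ^ suc n × InMinx (u i) ≐ InMinx (u (suc d + i)))
minx-repeats {n} u with i , j , i<j , code≡ ← pigeonhole (ℕₚ.n<1+n _) (minxCode ∘ u ∘ toℕ) =
  toℕ i , d , subst (ℕ._≤ 2 ^ suc n) (sym j≡) (toℕ≤pred[n] j) ,
  subst (λ k → InMinx (u (toℕ i)) ≐ InMinx (u k)) (sym (trans (cong suc (ℕₚ.+-comm d (toℕ i))) j≡))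
    (minxCode-injective code≡)
  where
  d = toℕ j ∸ suc (toℕ i)
  j≡ : suc (toℕ i + d) ≡ toℕ j
  j≡ = ℕₚ.m+[n∸m]≡n i<j

module _ {f : ℚ → ℚ} (f-inc : StrictlyIncreasing f) where

  strictlyIncreasing⇒mono-≤ : ∀ {x y} → x ≤ y → f x ≤ f y
  strictlyIncreasing⇒mono-≤ {x} {y} x≤y with ℚₚ.<-cmp x y
  ... | tri< x<y _ _ = ℚₚ.<⇒≤ (f-inc x y x<y)
  ... | tri≈ _ refl _ = ℚₚ.≤-refl
  ... | tri> _ _ y<x = ⊥-elim (ℚₚ.<-irrefl refl (ℚₚ.<-≤-trans y<x x≤y))

  strictlyIncreasing⇒injective : ∀ {x y} → f x ≡ f y → x ≡ y
  strictlyIncreasing⇒injective {x} {y} fx≡fy with ℚₚ.<-cmp x y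
  ... | tri< x<y _ _ = ⊥-elim (ℚₚ.<⇒≢ (f-inc x y x<y) fx≡fy)
  ... | tri≈ _ x≡y _ = x≡y
  ... | tri> _ _ y<x = ⊥-elim (ℚₚ.<⇒≢ (f-inc y x y<x) (sym fx≡fy))

  minQ-∘ : ∀ {n} (u : Qv (suc n)) → minQ (f ∘ u) ≡ f (minQ u)
  minQ-∘ u with l , ul≡min ← minQ-attained u =
    attained-bound⇒minQ≡ (λ j → strictlyIncreasing⇒mono-≤ (minQ-≤ u j)) (cong f ul≡min)

  InMinx-∘ : ∀ {n} (u : Qv (suc n)) → InMinx (f ∘ u) ≐ InMinx u
  InMinx-∘ u = (λ e → strictlyIncreasing⇒injective (trans e (minQ-∘ u))) ,
               (λ e → trans (cong f e) (sym (minQ-∘ u)))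

-- The operation mi

x+[y-x]≡y : ∀ x y → x ℚ.+ (y ℚ.- x) ≡ y
x+[y-x]≡y = solve 2 (λ x y → x :+ (y :- x) := y) refl
  where open ℚ-Solver.+-*-Solver

0<y-x : ∀ {x y} → x < y → 0ℚ < y ℚ.- x
0<y-x {x} {y} x<y = subst (_< y ℚ.- x) (ℚₚ.+-inverseʳ x) (ℚₚ.+-monoˡ-< (ℚ.- x) x<y)

module _ {α β γ : ℚ → ℚ} where

  Admissible-+ : Admissible α β γ → ∀ c →
    Admissible (λ x → α x ℚ.+ c) (λ x → β x ℚ.+ c) (λ x → γ x ℚ.+ c)
  Admissible-+ (α-inc , β-inc , γ-inc , gaps) c =
    (λ x y x<y → shift (α-inc x y x<y)) , (λ x y x<y → shift (β-inc x y x<y)) ,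
    (λ x y x<y → shift (γ-inc x y x<y)) ,
    λ x ε 0<ε → let (αβ , βγ , γα) = gaps x ε 0<ε in shift αβ , shift βγ , shift γα
    where
    shift : ∀ {p q} → p < q → p ℚ.+ c < q ℚ.+ c
    shift = ℚₚ.+-monoˡ-< c

  mi-< : ∀ {x y} → x < y → mi α β γ x y ≡ β x
  mi-< {x} {y} x<y with ℚₚ.<-cmp x y
  ... | tri< _ _ _    = cong β (ℚₚ.p≤q⇒p⊓q≡p (ℚₚ.<⇒≤ x<y))
  ... | tri≈ x≮y _ _  = ⊥-elim (x≮y x<y)
  ... | tri> x≮y _ _  = ⊥-elim (x≮y x<y)

  mi-≡ : ∀ x → mi α β γ x x ≡ α x
  mi-≡ x with ℚₚ.<-cmp x x
  ... | tri< x<x _ _ = ⊥-elim (ℚₚ.<-irrefl refl x<x)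
  ... | tri≈ _ _ _   = cong α (ℚₚ.⊓-idem x)
  ... | tri> _ _ x<x = ⊥-elim (ℚₚ.<-irrefl refl x<x)

  mi-> : ∀ {x y} → y < x → mi α β γ x y ≡ γ y
  mi-> {x} {y} y<x with ℚₚ.<-cmp x y
  ... | tri< _ _ y≯x  = ⊥-elim (y≯x y<x)
  ... | tri≈ _ _ y≯x  = ⊥-elim (y≯x y<x)
  ... | tri> _ _ _    = cong γ (ℚₚ.p≥q⇒p⊓q≡q (ℚₚ.<⇒≤ y<x))

module MiProperties {α β γ : ℚ → ℚ} (adm : Admissible α β γ) where

  private
    α-inc = proj₁ adm
    γ-inc = proj₁ (proj₂ (proj₂ adm))
    gaps = proj₂ (proj₂ (proj₂ adm))
    0<1 : 0ℚ < 1ℚ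
    0<1 = from-yes (0ℚ ℚ.<? 1ℚ)

  α<β : ∀ x → α x < β x
  α<β x = proj₁ (gaps x 1ℚ 0<1)

  β<γ : ∀ x → β x < γ x
  β<γ x = proj₁ (proj₂ (gaps x 1ℚ 0<1))

  α<γ : ∀ x → α x < γ x
  α<γ x = ℚₚ.<-trans (α<β x) (β<γ x)

  γ<α : ∀ {x y} → x < y → γ x < α y
  γ<α {x} {y} x<y = subst (λ t → γ x < α t) (x+[y-x]≡y x y) (proj₂ (proj₂ (gaps x (y ℚ.- x) (0<y-x x<y))))

  data MiCase (m x y : ℚ) : Set where
    both  : x ≡ m → y ≡ m → mi α β γ x y ≡ α m → MiCase m x y
    left  : x ≡ m → m < y → mi α β γ x y ≡ β m → MiCase m x y
    right : m < x → γ m ≤ mi α β γ x y → MiCase m x y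

  miCase : ∀ {m x y} → m ≤ x → m ≤ y → MiCase m x y
  miCase {m} {x} {y} m≤x m≤y with ℚₚ.<-cmp x y | ℚₚ.<-cmp m x
  ... | _             | tri> _ _ x<m = ⊥-elim (ℚₚ.<-irrefl refl (ℚₚ.<-≤-trans x<m m≤x))
  ... | tri< x<y _ _  | tri≈ _ refl _ = left refl x<y (mi-< x<y)
  ... | tri< x<y _ _  | tri< m<x _ _ =
    right m<x (subst (γ m ≤_) (sym (mi-< x<y)) (ℚₚ.<⇒≤ (ℚₚ.<-trans (γ<α m<x) (α<β x))))
  ... | tri≈ _ refl _ | tri≈ _ refl _ = both refl refl (mi-≡ x)
  ... | tri≈ _ refl _ | tri< m<x _ _ =
    right m<x (subst (γ m ≤_) (sym (mi-≡ x)) (ℚₚ.<⇒≤ (γ<α m<x)))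
  ... | tri> _ _ y<x  | _            =
    right (ℚₚ.≤-<-trans m≤y y<x) (subst (γ m ≤_) (sym (mi-> y<x)) (strictlyIncreasing⇒mono-≤ γ-inc m≤y))

  module _ {n : ℕ} {u u′ : Qv (suc n)} {m : ℚ} (u-min : minQ u ≡ m) (u′-min : minQ u′ ≡ m) where

    private
      U = miV α β γ u u′

      case : ∀ j → MiCase m (u j) (u′ j)
      case j = miCase (minQ≡⇒≤ u-min j) (minQ≡⇒≤ u′-min j)

      at-min : ∀ {v : Qv (suc n)} {k} → minQ v ≡ k → InMinx v ≐ (λ j → v j ≡ k)
      at-min = minQ≡⇒InMinx≐

      common : ∀ {j} → u j ≡ m → u′ j ≡ m → (InMinx u ∩ InMinx u′) j
      common u≡m u′≡m = proj₂ (at-min u-min) u≡m , proj₂ (at-min u′-min) u′≡m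

      >⇒≢ : ∀ {x} → m < x → x ≢ m
      >⇒≢ m<x x≡m = ℚₚ.<⇒≢ m<x (sym x≡m)

      <⇒≱ : ∀ {p q} → p < q → ¬ (q ≤ p)
      <⇒≱ p<q q≤p = ℚₚ.<-irrefl refl (ℚₚ.<-≤-trans p<q q≤p)

    miV-minQ-common : Satisfiable (InMinx u ∩ InMinx u′) → minQ U ≡ α m
    miV-minQ-common (l , ul , u′l) = attained-bound⇒minQ≡ bound attained
      where
      bound : ∀ j → α m ≤ U j
      bound j with case j
      ... | both _ _ U≡α    = ℚₚ.≤-reflexive (sym U≡α)
      ... | left _ _ U≡β    = ℚₚ.≤-trans (ℚₚ.<⇒≤ (α<β m)) (ℚₚ.≤-reflexive (sym U≡β))
      ... | right _ γ≤U     = ℚₚ.≤-trans (ℚₚ.<⇒≤ (α<γ m)) γ≤U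
      attained : U l ≡ α m
      attained with case l
      ... | both _ _ U≡α    = U≡α
      ... | left _ m<u′ _   = ⊥-elim (>⇒≢ m<u′ (proj₁ (at-min u′-min) u′l))
      ... | right m<u _     = ⊥-elim (>⇒≢ m<u (proj₁ (at-min u-min) ul))

    miV-InMinx-common : Satisfiable (InMinx u ∩ InMinx u′) → InMinx U ≐ InMinx u ∩ InMinx u′
    miV-InMinx-common sat = to , from
      where
      U-min = miV-minQ-common sat
      to : InMinx U ⊆ InMinx u ∩ InMinx u′
      to {j} Uj with case j | proj₁ (at-min U-min) Uj
      ... | both u≡m u′≡m _ | _   = common u≡m u′≡m
      ... | left _ _ U≡β    | U≡α = ⊥-elim (ℚₚ.<⇒≢ (α<β m) (trans (sym U≡α) U≡β))
      ... | right _ γ≤U     | U≡α = ⊥-elim (<⇒≱ (α<γ m) (subst (γ m ≤_) U≡α γ≤U))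
      from : InMinx u ∩ InMinx u′ ⊆ InMinx U
      from {j} (uj , u′j) with case j
      ... | both _ _ U≡α    = proj₂ (at-min U-min) U≡α
      ... | left _ m<u′ _   = ⊥-elim (>⇒≢ m<u′ (proj₁ (at-min u′-min) u′j))
      ... | right m<u _     = ⊥-elim (>⇒≢ m<u (proj₁ (at-min u-min) uj))

    miV-minQ-disjoint : Empty (InMinx u ∩ InMinx u′) → minQ U ≡ β m
    miV-minQ-disjoint disjoint = attained-bound⇒minQ≡ bound attained
      where
      l = proj₁ (minQ-attained u)
      bound : ∀ j → β m ≤ U j
      bound j with case j
      ... | both u≡m u′≡m _ = ⊥-elim (disjoint j (common u≡m u′≡m))
      ... | left _ _ U≡β    = ℚₚ.≤-reflexive (sym U≡β)
      ... | right _ γ≤U     = ℚₚ.≤-trans (ℚₚ.<⇒≤ (β<γ m)) γ≤U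
      attained : U l ≡ β m
      attained with case l
      ... | both u≡m u′≡m _ = ⊥-elim (disjoint l (common u≡m u′≡m))
      ... | left _ _ U≡β    = U≡β
      ... | right m<u _     = ⊥-elim (>⇒≢ m<u (proj₁ (at-min u-min) (proj₂ (minQ-attained u))))

  module _ {n : ℕ} (u : Qv (suc n)) where

    miV-diag-minQ : minQ (miV α β γ u u) ≡ α (minQ u)
    miV-diag-minQ = trans (minQ-cong (λ j → mi-≡ (u j))) (minQ-∘ α-inc u)

    miV-diag-InMinx : InMinx (miV α β γ u u) ≐ InMinx u
    miV-diag-InMinx = ≐-trans (InMinx-cong (λ j → mi-≡ (u j))) (InMinx-∘ α-inc u)

-- Combining edges with mi

≐⇒⇔ : ∀ {A : Set} {P Q : Pred A 0ℓ} → P ≐ Q → ∀ x → P x ⇔ Q x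
≐⇒⇔ (P⊆Q , Q⊆P) _ = mk⇔ P⊆Q Q⊆P

∩-cong : ∀ {A : Set} {P P′ Q Q′ : Pred A 0ℓ} → P ≐ P′ → Q ≐ Q′ → P ∩ Q ≐ P′ ∩ Q′
∩-cong (P⊆P′ , P′⊆P) (Q⊆Q′ , Q′⊆Q) =
  (λ (p , q) → P⊆P′ p , Q⊆Q′ q) , (λ (p , q) → P′⊆P p , Q′⊆Q q)

module _ {n : ℕ} {u v : Qv (suc n)} where

  minClean-≢ : minQ u ≢ minQ v → MinClean (tup u v)
  minClean-≢ u≢v zero          zero          _  _  = ≐⇒⇔ ≐-refl
  minClean-≢ u≢v zero          (suc zero)    Mu Mv = ⊥-elim (u≢v (trans Mu (sym Mv)))
  minClean-≢ u≢v (suc zero)    zero          Mv Mu = ⊥-elim (u≢v (trans Mu (sym Mv)))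
  minClean-≢ u≢v (suc zero)    (suc zero)    _  _  = ≐⇒⇔ ≐-refl

  minClean-≐ : InMinx u ≐ InMinx v → MinClean (tup u v)
  minClean-≐ u≐v zero       zero       _ _ = ≐⇒⇔ ≐-refl
  minClean-≐ u≐v zero       (suc zero) _ _ = ≐⇒⇔ u≐v
  minClean-≐ u≐v (suc zero) zero       _ _ = ≐⇒⇔ (≐-sym u≐v)
  minClean-≐ u≐v (suc zero) (suc zero) _ _ = ≐⇒⇔ ≐-refl

CleanEdge : ∀ {n} → BinRel (suc n) → Set
CleanEdge E = ∃[ a ] ∃[ b ] (E a b × MinClean (tup a b))

module Combination {n : ℕ} (E : BinRel (suc n)) (pres : PreservedByMi E)
                   {α β γ : ℚ → ℚ} (adm : Admissible α β γ) where

  Positions : Set₁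
  Positions = Pred (Fin (suc n)) 0ℓ

  record BalancedEdge (m : ℚ) (P Q : Positions) : Set where
    field
      {src tgt} : Qv (suc n)
      edge      : E src tgt
      src-min   : minQ src ≡ m
      tgt-min   : minQ tgt ≡ m
      src-minx  : InMinx src ≐ P
      tgt-minx  : InMinx tgt ≐ Q
  open BalancedEdge

  data Outcome (P Q : Positions) : Set where
    clean    : CleanEdge E → Outcome P Q
    realised : ∀ {m} → BalancedEdge m P Q → Outcome P Q
    empty    : Empty P → Empty Q → Outcome P Q

  outcome-edge : ∀ {a b} → E a b → Outcome (InMinx a) (InMinx b)
  outcome-edge {a} {b} e with minQ a ℚ.≟ minQ b
  ... | no  a≢b = clean (a , b , e , minClean-≢ a≢b)
  ... | yes a≡b = realised record
    { edge = e ; src-min = a≡b ; tgt-min = refl ; src-minx = ≐-refl ; tgt-minx = ≐-refl }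

  -- Applying mi for the triple shifted by m′ - α m to an edge and itself
  -- moves its common minimum from m to m′.
  balanced-shift : ∀ {m P Q} → BalancedEdge m P Q → ∀ m′ → BalancedEdge m′ P Q
  balanced-shift {m} b m′ = record
    { edge     = pres _ _ _ adm′ _ _ _ _ (edge b) (edge b)
    ; src-min  = trans (miV-diag-minQ (src b)) (moved (src-min b))
    ; tgt-min  = trans (miV-diag-minQ (tgt b)) (moved (tgt-min b))
    ; src-minx = ≐-trans (miV-diag-InMinx (src b)) (src-minx b)
    ; tgt-minx = ≐-trans (miV-diag-InMinx (tgt b)) (tgt-minx b)
    }
    where
    adm′ = Admissible-+ adm (m′ ℚ.- α m)
    open MiProperties adm′ using (miV-diag-minQ; miV-diag-InMinx)
    moved : ∀ {x} → x ≡ m → α x ℚ.+ (m′ ℚ.- α m) ≡ m′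
    moved refl = x+[y-x]≡y (α m) m′

  open MiProperties adm

  balanced-∩ : ∀ {m P Q P′ Q′} → BalancedEdge m P Q → BalancedEdge m P′ Q′ →
               Outcome (P ∩ P′) (Q ∩ Q′)
  balanced-∩ {m} {P} {Q} {P′} {Q′} b b′ =
    combine (any? (InMinx? (src b) ∩? InMinx? (src b′))) (any? (InMinx? (tgt b) ∩? InMinx? (tgt b′)))
    where
    E-UV : E (miV α β γ (src b) (src b′)) (miV α β γ (tgt b) (tgt b′))
    E-UV = pres α β γ adm _ _ _ _ (edge b) (edge b′)

    src-common = miV-minQ-common (src-min b) (src-min b′)
    tgt-common = miV-minQ-common (tgt-min b) (tgt-min b′)
    src-disjoint = miV-minQ-disjoint (src-min b) (src-min b′)
    tgt-disjoint = miV-minQ-disjoint (tgt-min b) (tgt-min b′)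

    combine : Dec (Satisfiable (InMinx (src b) ∩ InMinx (src b′))) →
              Dec (Satisfiable (InMinx (tgt b) ∩ InMinx (tgt b′))) → Outcome (P ∩ P′) (Q ∩ Q′)
    combine (yes S) (yes T) = realised record
      { edge     = E-UV
      ; src-min  = src-common S
      ; tgt-min  = tgt-common T
      ; src-minx = ≐-trans (miV-InMinx-common (src-min b) (src-min b′) S) (∩-cong (src-minx b) (src-minx b′))
      ; tgt-minx = ≐-trans (miV-InMinx-common (tgt-min b) (tgt-min b′) T) (∩-cong (tgt-minx b) (tgt-minx b′))
      }
    combine (yes S) (no ¬T) = clean (_ , _ , E-UV , minClean-≢ λ U≡V →
      ℚₚ.<⇒≢ (α<β m) (trans (sym (src-common S)) (trans U≡V (tgt-disjoint (curry ¬T)))))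
    combine (no ¬S) (yes T) = clean (_ , _ , E-UV , minClean-≢ λ U≡V →
      ℚₚ.<⇒≢ (α<β m) (trans (sym (tgt-common T)) (trans (sym U≡V) (src-disjoint (curry ¬S)))))
    combine (no ¬S) (no ¬T) =
      empty (λ j PP′ → ¬S (j , proj₂ (∩-cong (src-minx b) (src-minx b′)) PP′))
            (λ j QQ′ → ¬T (j , proj₂ (∩-cong (tgt-minx b) (tgt-minx b′)) QQ′))

  outcome-∩ : ∀ {P Q P′ Q′} → Outcome P Q → Outcome P′ Q′ → Outcome (P ∩ P′) (Q ∩ Q′)
  outcome-∩ (clean c)     _              = clean c
  outcome-∩ _             (clean c)      = clean c
  outcome-∩ (empty ¬P ¬Q) _              = empty (λ j → ¬P j ∘ proj₁) (λ j → ¬Q j ∘ proj₁)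
  outcome-∩ _             (empty ¬P ¬Q)  = empty (λ j → ¬P j ∘ proj₂) (λ j → ¬Q j ∘ proj₂)
  outcome-∩ (realised b)  (realised b′)  = balanced-∩ b (balanced-shift b′ _)

  private
    minx-satisfiable : ∀ {P : Positions} (u : Qv (suc n)) → InMinx u ≐ P → Satisfiable P
    minx-satisfiable u (to , _) = let (l , ul) = minQ-attained u in l , to ul

  outcome-forward : ∀ {P Q} → Outcome P Q → Satisfiable P → CleanEdge E ⊎ Satisfiable Q
  outcome-forward (clean c)    _       = inj₁ c
  outcome-forward (realised b) _       = inj₂ (minx-satisfiable (tgt b) (tgt-minx b))
  outcome-forward (empty ¬P _) (j , p) = ⊥-elim (¬P j p)

  outcome-backward : ∀ {P Q} → Outcome P Q → Satisfiable Q → CleanEdge E ⊎ Satisfiable P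
  outcome-backward (clean c)    _       = inj₁ c
  outcome-backward (realised b) _       = inj₂ (minx-satisfiable (src b) (src-minx b))
  outcome-backward (empty _ ¬Q) (j , q) = ⊥-elim (¬Q j q)

  outcome-loop : ∀ {P Q} → Outcome P Q → Satisfiable P → P ≐ Q → CleanEdge E
  outcome-loop (clean c)    _       _   = c
  outcome-loop (realised b) _       P≐Q =
    _ , _ , edge b , minClean-≐ (≐-trans (src-minx b) (≐-trans P≐Q (≐-sym (tgt-minx b))))
  outcome-loop (empty ¬P _) (j , p) _   = ⊥-elim (¬P j p)

-- Windows along a path

smooth-path : ∀ {n} {E : BinRel (suc n)} → Smooth E → ∀ {w w′} → E w w′ →
  Σ[ c ∈ (ℤ → Qv (suc n)) ] (c 0ℤ ≡ w × ∀ z → E (c z) (c (ℤ.suc z)))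
smooth-path {n} {E} smooth {w} {w′} e = c , refl , c-edge
  where
  Out In : Qv (suc n) → Set
  Out x = ∃[ y ] E x y
  In x = ∃[ y ] E y x

  forward : ℕ → Σ (Qv (suc n)) Out
  forward zero = w , w′ , e
  forward (suc i) with x , y , xy ← forward i = y , Equivalence.from (smooth y) (x , xy)

  backward : ℕ → Σ (Qv (suc n)) In
  backward zero = w , Equivalence.to (smooth w) (w′ , e)
  backward (suc i) with y , x , xy ← backward i = x , Equivalence.to (smooth x) (y , xy)

  c : ℤ → Qv (suc n)
  c (+ i)      = proj₁ (forward i)
  c -[1+ i ]   = proj₁ (backward (suc i))

  c-edge : ∀ z → E (c z) (c (ℤ.suc z))
  c-edge (+ i)          = proj₂ (proj₂ (forward i))
  c-edge -[1+ zero ]    = proj₂ (proj₂ (backward 0))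
  c-edge -[1+ suc i ]   = proj₂ (proj₂ (backward (suc i)))

module _ {n} {E : BinRel (suc n)} where

  advance : ∀ {x y f b} → Walk E x y f b → ℤ → ℤ
  advance nil         h = h
  advance (fwd _ wk)  h = advance wk (ℤ.suc h)
  advance (bwd _ wk)  h = advance wk (ℤ.pred h)

  advance-≡ : ∀ {x y f b} (wk : Walk E x y f b) h → advance wk h ≡ h ℤ.+ (+ f ℤ.- + b)
  advance-≡ nil h = sym (ℤₚ.+-identityʳ h)
  advance-≡ {f = suc f} {b} (fwd _ wk) h = trans (advance-≡ wk (ℤ.suc h))
    (solve 3 (λ h f b → (con 1ℤ :+ h) :+ (f :- b) := h :+ ((con 1ℤ :+ f) :- b)) refl h (+ f) (+ b))
    where open ℤ-Solver.+-*-Solver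
  advance-≡ {f = f} {suc b} (bwd _ wk) h = trans (advance-≡ wk (ℤ.pred h))
    (solve 3 (λ h f b → (con (ℤ.- 1ℤ) :+ h) :+ (f :- b) := h :+ (f :- (con 1ℤ :+ b))) refl h (+ f) (+ b))
    where open ℤ-Solver.+-*-Solver

  advance-closed : ∀ {x y b} (wk : Walk E x y (suc b) b) h → advance wk h ≡ ℤ.suc h
  advance-closed {b = b} wk h = trans (advance-≡ wk h)
    (solve 2 (λ h b → h :+ ((con 1ℤ :+ b) :- b) := con 1ℤ :+ h) refl h (+ b))
    where open ℤ-Solver.+-*-Solver

module Windows {n : ℕ} (E : BinRel (suc n)) (pres : PreservedByMi E)
               {α β γ : ℚ → ℚ} (adm : Admissible α β γ)
               (c : ℤ → Qv (suc n)) (c-edge : ∀ z → E (c z) (c (ℤ.suc z))) where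

  open Combination E pres adm

  Window : ℤ → ℕ → Positions
  Window h zero    = InMinx (c h)
  Window h (suc m) = InMinx (c h) ∩ Window (ℤ.suc h) m

  window-outcome : ∀ h m → Outcome (Window h m) (Window (ℤ.suc h) m)
  window-outcome h zero    = outcome-edge (c-edge h)
  window-outcome h (suc m) = outcome-∩ (outcome-edge (c-edge h)) (window-outcome (ℤ.suc h) m)

  Reach : Qv (suc n) → ℤ → ℕ → Set
  Reach x h m = Satisfiable (InMinx x ∩ Window h m)

  module _ {m : ℕ} where

    reach-forward : ∀ {x y h} → ClassEdge E x y → Reach x h m → CleanEdge E ⊎ Reach y (ℤ.suc h) m
    reach-forward {h = h} (a , b , ab , a∼x , b∼y) (l , xl , wl)
      = map₂ (λ (l′ , bl′ , wl′) → l′ , ∼⇒InMinx⊆ b∼y bl′ , wl′)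
          (outcome-forward (outcome-∩ (outcome-edge ab) (window-outcome h m))
             (l , proj₂ (∼⇒InMinx≐ a∼x) xl , wl))

    reach-backward : ∀ {x y h} → ClassEdge E y x → Reach x h m → CleanEdge E ⊎ Reach y (ℤ.pred h) m
    reach-backward {h = h} (a , b , ab , a∼y , b∼x) (l , xl , wl)
      = map₂ (λ (l′ , al′ , wl′) → l′ , ∼⇒InMinx⊆ a∼y al′ , wl′)
          (outcome-backward (outcome-∩ (outcome-edge ab) (window-outcome (ℤ.pred h) m))
             (l , proj₂ (∼⇒InMinx≐ b∼x) xl , subst (λ h′ → Window h′ m l) (sym (ℤₚ.suc-pred h)) wl))

    reach-walk : ∀ {x y f b h} (wk : Walk E x y f b) → Reach x h m → CleanEdge E ⊎ Reach y (advance wk h) m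
    reach-walk nil        r = inj₂ r
    reach-walk (fwd e wk) r = [ inj₁ , reach-walk wk ]′ (reach-forward e r)
    reach-walk (bwd e wk) r = [ inj₁ , reach-walk wk ]′ (reach-backward e r)

  reach-all : ∀ {x y b} → Walk E x y (suc b) b → y ∼ x → InMinx (c 0ℤ) ≐ InMinx x →
              ∀ m → CleanEdge E ⊎ Reach x 0ℤ m
  reach-all _  _   c₀≐x zero    =
    let (l , c₀l) = minQ-attained (c 0ℤ) in inj₂ (l , proj₁ c₀≐x c₀l , c₀l)
  reach-all wk y∼x c₀≐x (suc m) with reach-all wk y∼x c₀≐x m
  ... | inj₁ found = inj₁ found
  ... | inj₂ r with reach-walk {m} wk r
  ...   | inj₁ found = inj₁ found
  ...   | inj₂ (l , yl , wl) =
    inj₂ (l , xl , proj₂ c₀≐x xl , subst (λ h → Window h m l) (advance-closed wk 0ℤ) wl)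
    where xl = ∼⇒InMinx⊆ y∼x yl

  Window-prefix : ∀ h {d m} → d ℕ.≤ m → Window h m ⊆ Window h d
  Window-prefix h {zero}  {zero}  _         = id
  Window-prefix h {zero}  {suc m} _         = proj₁
  Window-prefix h {suc d} {suc m} (s≤s d≤m) = Product.map₂ (Window-prefix (ℤ.suc h) d≤m)

  Window-suffix : ∀ i d → Window 0ℤ (i + d) ⊆ Window (+ i) d
  Window-suffix zero    d = id
  Window-suffix (suc i) d {l} =
    proj₂ ∘ Window-suffix i (suc d) ∘ subst (λ m → Window 0ℤ m l) (sym (ℕₚ.+-suc i d))

  Window-snoc : ∀ i m → Window (+ i) (suc m) ≐ Window (+ i) m ∩ InMinx (c (+ (suc m + i)))
  Window-snoc i zero    = ≐-refl
  Window-snoc i (suc m) =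
    (λ {l} (ci , w) → let (w′ , e) = proj₁ (Window-snoc (suc i) m) w in
                      (ci , w′) , subst (end l) (ℕₚ.+-suc (suc m) i) e) ,
    (λ {l} ((ci , w′) , e) →
       ci , proj₂ (Window-snoc (suc i) m) (w′ , subst (end l) (sym (ℕₚ.+-suc (suc m) i)) e))
    where end = λ l k → InMinx (c (+ k)) l

  Window-rotate : ∀ i d → InMinx (c (+ i)) ≐ InMinx (c (+ (suc d + i))) → Window (+ i) d ≐ Window (+ suc i) d
  Window-rotate i zero    ends = ends
  Window-rotate i (suc d) (to , from) =
    (λ {l} (ci , w) → proj₂ (Window-snoc (suc i) d) (w , subst (end l) (sym (ℕₚ.+-suc (suc d) i)) (to ci))) ,
    (λ {l} w → let (w′ , e) = proj₁ (Window-snoc (suc i) d) w in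
               from (subst (end l) (ℕₚ.+-suc (suc d) i) e) , w′)
    where end = λ l k → InMinx (c (+ k)) l

  window-repeat : Satisfiable (Window 0ℤ (2 ^ suc n)) → CleanEdge E
  window-repeat (l , wl) with i , d , bound , ends ← minx-repeats (c ∘ +_) =
    outcome-loop (window-outcome (+ i) d)
      (l , Window-suffix i d (Window-prefix 0ℤ (ℕₚ.<⇒≤ bound) wl))
      (Window-rotate i d ends)

walk-anchor : ∀ {n} {E : BinRel (suc n)} → Smooth E → ∀ {x y f b} → Walk E x y (suc f) b →
  ∃[ w ] ∃[ w′ ] (E w w′ × w ∼ x)
walk-anchor smooth (fwd (a , b , ab , a∼x , _) _) = a , b , ab , a∼x
walk-anchor smooth (bwd (a , b , ab , _ , b∼x) _) =
  let (b′ , bb′) = Equivalence.from (smooth b) (a , ab) in b , b′ , bb′ , b∼x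

lemma5p5 : (n : ℕ) (E : BinRel (suc n)) →
    Nonempty E → Smooth E → PseudoAlgLength1 E → PreservedByMi E →
    ∃[ a ] ∃[ b ] (E a b × MinClean (tup a b))
lemma5p5 n E _ smooth (x , y , _ , b , walk , y∼x , refl) pres
  with w , w′ , ww′ , w∼x ← walk-anchor smooth walk
  with c , c₀≡w , c-edge ← smooth-path smooth ww′ =
  let open Windows E pres sternBrocot-admissible c c-edge
      c₀∼x = subst (_∼ x) (sym c₀≡w) w∼x
  in [ id , window-repeat ∘ Product.map₂ proj₂ ]′ (reach-all walk y∼x (∼⇒InMinx≐ c₀∼x) (2 ^ suc n))
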